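{- Let $b\ge 0$ and $e>0$ be integers and $a=2b+e$. Let $n\ge 1$, let $P_{n+1}$ be the path with vertices $v_0,\dots,v_n$ and edges $v_iv_{i+1}$, and let $L$ be a list assignment with $|L(0)|=|L(n)|=b$ and $|L(i)|=a$ for all $i\in\{1,\dots,n-1\}$. If $n\ge \mathrm{Even}(2b/e)$, then $P_{n+1}$ is $(L,b)$-colorable, i.e. one can choose for each $i$ a set $c(i)\subseteq L(i)$ with $|c(i)|=b$ such that $c(i)\cap c(i+1)=\emptyset$ for all $0\le i\le n-1$.
   Context: $L(i)$ denotes the list (a finite subset of $\mathbb{N}$) assigned to $v_i$. For a real $x$, $\mathrm{Even}(x)$ is the smallest even integer $p$ with $p\ge x$. -}

module Defs where

open import Data.Nat using (ℕ; _+_; _*_; _≤_; _<_)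
open import Data.Product using (Σ; _×_; ∃)
open import Data.List using (List; length)
open import Data.List.Relation.Unary.Unique.Propositional using (Unique)
open import Data.List.Membership.Propositional using (_∈_)
open import Relation.Nullary using (¬_)

-- A finite subset of ℕ is represented as a duplicate-free list; its size is its length.
-- Subset relation on lists (as sets).
_⊆ˢ_ : List ℕ → List ℕ → Set
xs ⊆ˢ ys = ∀ {x} → x ∈ xs → x ∈ ys

Disjoint : List ℕ → List ℕ → Set
Disjoint xs ys = ∀ {x} → x ∈ xs → ¬ (x ∈ ys)

-- Even(2b/e) for e > 0: the smallest even integer p with p ≥ 2b/e,
-- i.e. p * e ≥ 2 * b (p is a natural number since 2b/e ≥ 0).
IsEvenCeil2bOverE : ℕ → ℕ → ℕ → Set
IsEvenCeil2bOverE b e p =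
  (∃ λ k → p ≡ 2 * k) × (2 * b ≤ p * e) ×
  (∀ q → (∃ λ k → q ≡ 2 * k) → 2 * b ≤ q * e → p ≤ q)
  where open import Relation.Binary.PropositionalEquality using (_≡_)

LbColorablePath : ℕ → (ℕ → List ℕ) → ℕ → Set
LbColorablePath n L b =
  Σ (ℕ → List ℕ) λ c →
    (∀ i → i ≤ n → Unique (c i) × (c i ⊆ˢ L i) × length (c i) ≡ b) ×
    (∀ i → i < n → Disjoint (c i) (c (1 + i)))
  where open import Relation.Binary.PropositionalEquality using (_≡_)

-- Colour the path greedily from v₀ towards vₙ.  Read backwards from vₙ, the lists
-- determine "forced" sets F₀ = L(n), F_{d+1} = L(n-d-1) ∖ F_d: the colours at v_{n-d-1}
-- that the rest of the path does not already account for.  At vᵢ one takes b colours of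
-- L(i) ∖ c(i-1), using colours of the forced set of v_{i+1} only when unavoidable; then
-- at most s_d of them are forced, where d is the distance of v_{i+1} from vₙ, s₀ = 0 and
-- s_{d+1} = |F_{d+1}| + s_d - b.  As F₀ = L(n), c(n-1) misses L(n).  Two consecutive
-- forced sets cover an inner list of size 2b+e, so the slack grows by e every two steps
-- and s_{n-1} ≥ ⌈(n-1)/2⌉e ≥ b when n ≥ Even(2b/e); that is exactly what the first step,
-- with c(0) = L(0), requires.

module Submission where

open import Defs
open import Data.Nat using (ℕ; zero; suc; _+_; _*_; _∸_; _≤_; _<_; z≤n; s≤s; ⌊_/2⌋; ⌈_/2⌉)
open import Data.Nat.Properties
open import Data.Nat.Tactic.RingSolver using (solve-∀)
open import Data.List using (List; []; _∷_; length; filter; take; _++_)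
open import Data.List.Properties using (length-filter; filter-notAll; length-take; length-++)
open import Data.List.Relation.Unary.Unique.Propositional using (Unique)
import Data.List.Relation.Unary.Unique.Propositional.Properties as Unique
open import Data.List.Relation.Unary.AllPairs using (_∷_)
open import Data.List.Relation.Unary.All as All using (All; _∷_)
open import Data.List.Relation.Unary.Any as Any using (here; there)
open import Data.List.Membership.Propositional using (_∈_; _∉_)
open import Data.List.Membership.Propositional.Properties using (∈-filter⁺; ∈-filter⁻; ∈-++⁻)
open import Data.List.Relation.Binary.Subset.Propositional using (_⊆_)
open import Data.List.Relation.Binary.Sublist.Propositional using (lookup)
open import Data.List.Relation.Binary.Sublist.Propositional.Properties using (take-⊆)
open import Data.Product using (_×_; _,_; proj₁; proj₂)
open import Data.Sum using (inj₁; inj₂)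
open import Function using (_∘_)
open import Relation.Binary.Definitions using (DecidableEquality)
open import Relation.Nullary using (yes; no; ¬?)
open import Relation.Nullary.Negation using (contradiction)
open import Relation.Binary.PropositionalEquality using (_≡_; refl; sym; trans; cong; subst)

module ListSets {A : Set} (_≟_ : DecidableEquality A) where

  open import Data.List.Membership.DecPropositional _≟_ using (_∈?_)

  infixl 6 _∖_ _∩_

  _∖_ : List A → List A → List A
  xs ∖ ys = filter (λ x → ¬? (x ∈? ys)) xs

  _∩_ : List A → List A → List A
  xs ∩ ys = filter (_∈? ys) xs

  ∈-∖⁻ : ∀ {x} xs ys → x ∈ xs ∖ ys → x ∈ xs × x ∉ ys
  ∈-∖⁻ xs ys = ∈-filter⁻ (λ x → ¬? (x ∈? ys)) {xs = xs}

  ∈-∩⁻ : ∀ {x} xs ys → x ∈ xs ∩ ys → x ∈ xs × x ∈ ys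
  ∈-∩⁻ xs ys = ∈-filter⁻ (_∈? ys) {xs = xs}

  ∖⁺ : ∀ {xs} ys → Unique xs → Unique (xs ∖ ys)
  ∖⁺ ys = Unique.filter⁺ (λ x → ¬? (x ∈? ys))

  ∩⁺ : ∀ {xs} ys → Unique xs → Unique (xs ∩ ys)
  ∩⁺ ys = Unique.filter⁺ (_∈? ys)

  length-∩≤ : ∀ xs ys → length (xs ∩ ys) ≤ length xs
  length-∩≤ xs ys = length-filter (_∈? ys) xs

  length-∖+∩ : ∀ xs ys → length (xs ∖ ys) + length (xs ∩ ys) ≡ length xs
  length-∖+∩ []       ys = refl
  length-∖+∩ (x ∷ xs) ys with x ∈? ys
  ... | yes _ = trans (+-suc (length (xs ∖ ys)) (length (xs ∩ ys))) (cong suc (length-∖+∩ xs ys))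
  ... | no  _ = cong suc (length-∖+∩ xs ys)

  ∖-comm : ∀ xs ys zs → xs ∖ ys ∖ zs ≡ xs ∖ zs ∖ ys
  ∖-comm []       ys zs = refl
  ∖-comm (x ∷ xs) ys zs with x ∈? ys in eqy | x ∈? zs in eqz
  ... | yes _ | yes _ = ∖-comm xs ys zs
  ... | yes _ | no  _ rewrite eqy = ∖-comm xs ys zs
  ... | no  _ | yes _ rewrite eqz = ∖-comm xs ys zs
  ... | no  _ | no  _ rewrite eqy | eqz = cong (x ∷_) (∖-comm xs ys zs)

  Unique∧⊆⇒length≤ : ∀ {xs} ys → Unique xs → xs ⊆ ys → length xs ≤ length ys
  Unique∧⊆⇒length≤ {[]}     ys _          _   = z≤n
  Unique∧⊆⇒length≤ {x ∷ xs} ys (x∉xs ∷ u) sub =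
    ≤-trans (s≤s (Unique∧⊆⇒length≤ (filter ≢x? ys) u sub′))
            (filter-notAll ≢x? ys (Any.map (λ x≡y x≢y → x≢y (sym x≡y)) (sub (here refl))))
    where
    ≢x? = λ y → ¬? (y ≟ x)
    sub′ : xs ⊆ filter ≢x? ys
    sub′ z∈xs = ∈-filter⁺ ≢x? (sub (there z∈xs)) (λ z≡x → All.lookup x∉xs z∈xs (sym z≡x))

  length≤∖+∩ : ∀ {xs} ys → Unique xs → length xs ≤ length (xs ∖ ys) + length (ys ∩ xs)
  length≤∖+∩ {xs} ys u = begin
    length xs                           ≡⟨ sym (length-∖+∩ xs ys) ⟩
    length (xs ∖ ys) + length (xs ∩ ys) ≤⟨ +-monoʳ-≤ (length (xs ∖ ys)) ∩-swap ⟩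
    length (xs ∖ ys) + length (ys ∩ xs) ∎
    where
    open ≤-Reasoning
    ∩-swap : length (xs ∩ ys) ≤ length (ys ∩ xs)
    ∩-swap = Unique∧⊆⇒length≤ (ys ∩ xs) (∩⁺ ys u)
      (λ z∈ → let (z∈xs , z∈ys) = ∈-∩⁻ xs ys z∈ in ∈-filter⁺ (_∈? xs) z∈ys z∈xs)

  takeAvoiding : ℕ → List A → List A → List A
  takeAvoiding k zs xs = take k (xs ∖ zs ++ xs ∩ zs)

  takeAvoiding-⊆ : ∀ k zs xs → takeAvoiding k zs xs ⊆ xs
  takeAvoiding-⊆ k zs xs x∈ with ∈-++⁻ (xs ∖ zs) (lookup (take-⊆ k (xs ∖ zs ++ xs ∩ zs)) x∈)
  ... | inj₁ x∈∖ = proj₁ (∈-∖⁻ xs zs x∈∖)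
  ... | inj₂ x∈∩ = proj₁ (∈-∩⁻ xs zs x∈∩)

  takeAvoiding⁺ : ∀ k zs {xs} → Unique xs → Unique (takeAvoiding k zs xs)
  takeAvoiding⁺ k zs {xs} u = Unique.take⁺ k (Unique.++⁺ (∖⁺ zs u) (∩⁺ zs u)
    λ (x∈∖ , x∈∩) → proj₂ (∈-∖⁻ xs zs x∈∖) (proj₂ (∈-∩⁻ xs zs x∈∩)))

  length-take≤ : ∀ k (xs : List A) → length (take k xs) ≤ k
  length-take≤ k xs = ≤-trans (≤-reflexive (length-take k xs)) (m⊓n≤m k _)

  length-takeAvoiding : ∀ {k} zs xs → k ≤ length xs → length (takeAvoiding k zs xs) ≡ k
  length-takeAvoiding {k} zs xs k≤ = trans (length-take k _) (m≤n⇒m⊓n≡m (≤-trans k≤ (≤-reflexive (sym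
    (trans (length-++ (xs ∖ zs)) (length-∖+∩ xs zs))))))

  length-take-++-∩≤ : ∀ k xs ys zs → All (_∉ zs) xs → length (take k (xs ++ ys) ∩ zs) ≤ k ∸ length xs
  length-take-++-∩≤ zero    xs       ys zs _            = z≤n
  length-take-++-∩≤ (suc k) []       ys zs _            =
    ≤-trans (length-∩≤ (take (suc k) ys) zs) (length-take≤ (suc k) ys)
  length-take-++-∩≤ (suc k) (x ∷ xs) ys zs (x∉zs ∷ xs∉zs) with x ∈? zs
  ... | yes x∈zs = contradiction x∈zs x∉zs
  ... | no  _    = length-take-++-∩≤ k xs ys zs xs∉zs

  takeAvoiding-∩≤ : ∀ {k t} zs xs → k ≤ length (xs ∖ zs) + t → length (takeAvoiding k zs xs ∩ zs) ≤ t
  takeAvoiding-∩≤ {k} zs xs k≤ = ≤-trans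
    (length-take-++-∩≤ k (xs ∖ zs) (xs ∩ zs) zs (All.tabulate (proj₂ ∘ ∈-∖⁻ xs zs)))
    (m≤n+o⇒m∸n≤o k (length (xs ∖ zs)) k≤)

  takeAvoiding-∖-∩≤ : ∀ {k t} xs ys zs → Unique xs →
    length (ys ∩ (xs ∖ zs)) + k ≤ length (xs ∖ zs) + t →
    length (takeAvoiding k zs (xs ∖ ys) ∩ zs) ≤ t
  takeAvoiding-∖-∩≤ {k} {t} xs ys zs u hyp = takeAvoiding-∩≤ zs (xs ∖ ys) (+-cancelˡ-≤ s k _ (begin
    s + k                            ≤⟨ hyp ⟩
    length (xs ∖ zs) + t             ≤⟨ +-monoˡ-≤ t (length≤∖+∩ ys (∖⁺ zs u)) ⟩
    length (xs ∖ zs ∖ ys) + s + t    ≡⟨ cong (λ l → length l + s + t) (∖-comm xs zs ys) ⟩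
    length (xs ∖ ys ∖ zs) + s + t    ≡⟨ cong (_+ t) (+-comm _ s) ⟩
    s + length (xs ∖ ys ∖ zs) + t    ≡⟨ +-assoc s _ t ⟩
    s + (length (xs ∖ ys ∖ zs) + t)  ∎))
    where
    open ≤-Reasoning
    s = length (ys ∩ (xs ∖ zs))

open ListSets Data.Nat._≟_

x+y+y≡x+2y : ∀ x y → x + y + y ≡ x + 2 * y
x+y+y≡x+2y = solve-∀

x+y+z≡x+[z+y] : ∀ x y z → x + y + z ≡ x + (z + y)
x+y+z≡x+[z+y] = solve-∀

x+[y+z]≡y+[z+x] : ∀ x y z → x + (y + z) ≡ y + (z + x)
x+[y+z]≡y+[z+x] = solve-∀

2*q≤1+n⇒q≤⌈n/2⌉ : ∀ q n → 2 * q ≤ suc n → q ≤ ⌈ n /2⌉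
2*q≤1+n⇒q≤⌈n/2⌉ q n h = begin
  q              ≡⟨ n≡⌊n+n/2⌋ q ⟩
  ⌊ q + q /2⌋    ≤⟨ ⌊n/2⌋-mono (≤-trans (≤-reflexive (sym (cong (q +_) (+-identityʳ q)))) h) ⟩
  ⌊ suc n /2⌋    ∎
  where open ≤-Reasoning

module ForcedSets (b e m : ℕ) (K : ℕ → List ℕ) (uK : ∀ d → Unique (K d))
  (K₀≤b : length (K 0) ≤ b)
  (K-inner : ∀ d → 1 ≤ d → d < m → 2 * b + e ≤ length (K d)) where

  -- K d is the list of the vertex at distance d from the end of a path of length m.

  forced : ℕ → List ℕ
  forced zero    = K zero
  forced (suc d) = K (suc d) ∖ forced d

  slack : ℕ → ℕ
  slack zero    = 0
  slack (suc d) = length (forced (suc d)) + slack d ∸ b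

  length-forced+slack≤ : ∀ d → length (forced (suc d)) + slack d ≤ slack (suc d) + b
  length-forced+slack≤ d = ≤-trans (m≤n+m∸n _ b) (≤-reflexive (+-comm b _))

  length-forced≤ : ∀ d → length (forced d) ≤ slack d + b
  length-forced≤ zero    = K₀≤b
  length-forced≤ (suc d) = ≤-trans (m≤m+n _ (slack d)) (length-forced+slack≤ d)

  length-forced-pair≥ : ∀ d → suc d < m → 2 * b + e ≤ length (forced (suc d)) + length (forced d)
  length-forced-pair≥ d h = begin
    2 * b + e                                                ≤⟨ K-inner (suc d) (s≤s z≤n) h ⟩
    length (K (suc d))                                       ≤⟨ length≤∖+∩ (forced d) (uK (suc d)) ⟩
    length (forced (suc d)) + length (forced d ∩ K (suc d))  ≤⟨ +-monoʳ-≤ _ (length-∩≤ (forced d) _) ⟩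
    length (forced (suc d)) + length (forced d)              ∎
    where open ≤-Reasoning

  slack-suc : ∀ d → suc d < m → slack (suc d) + b ≡ length (forced (suc d)) + slack d
  slack-suc d h = m∸n+n≡m (+-cancelʳ-≤ b b _ (begin
    b + b                                      ≤⟨ +-monoʳ-≤ b (m≤m+n b 0) ⟩
    2 * b                                      ≤⟨ m≤m+n (2 * b) e ⟩
    2 * b + e                                  ≤⟨ length-forced-pair≥ d h ⟩
    length (forced (suc d)) + length (forced d) ≤⟨ +-monoʳ-≤ _ (length-forced≤ d) ⟩
    length (forced (suc d)) + (slack d + b)     ≡⟨ +-assoc _ (slack d) b ⟨
    length (forced (suc d)) + slack d + b       ∎))
    where open ≤-Reasoning

  slack-one : 1 < m → e ≤ slack 1
  slack-one h = +-cancelʳ-≤ (2 * b) e (slack 1) (begin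
    e + 2 * b                         ≡⟨ +-comm e (2 * b) ⟩
    2 * b + e                         ≤⟨ length-forced-pair≥ 0 h ⟩
    length (forced 1) + length (K 0)  ≤⟨ +-monoʳ-≤ _ K₀≤b ⟩
    length (forced 1) + b             ≡⟨ cong (_+ b) (+-identityʳ _) ⟨
    length (forced 1) + 0 + b         ≤⟨ +-monoˡ-≤ b (length-forced+slack≤ 0) ⟩
    slack 1 + b + b                   ≡⟨ x+y+y≡x+2y (slack 1) b ⟩
    slack 1 + 2 * b                   ∎)
    where open ≤-Reasoning

  slack-step : ∀ d → suc (suc d) < m → slack d + e ≤ slack (suc (suc d))
  slack-step d h = +-cancelʳ-≤ (2 * b) _ _ (begin
    slack d + e + 2 * b                      ≡⟨ x+y+z≡x+[z+y] (slack d) e (2 * b) ⟩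
    slack d + (2 * b + e)                    ≤⟨ +-monoʳ-≤ (slack d) (length-forced-pair≥ (suc d) h) ⟩
    slack d + (g₂ + g₁)                      ≡⟨ x+[y+z]≡y+[z+x] (slack d) g₂ g₁ ⟩
    g₂ + (g₁ + slack d)                      ≡⟨ cong (g₂ +_) (slack-suc d (<-trans (n<1+n _) h)) ⟨
    g₂ + (slack (suc d) + b)                 ≡⟨ +-assoc g₂ (slack (suc d)) b ⟨
    g₂ + slack (suc d) + b                   ≤⟨ +-monoˡ-≤ b (length-forced+slack≤ (suc d)) ⟩
    slack (suc (suc d)) + b + b              ≡⟨ x+y+y≡x+2y (slack (suc (suc d))) b ⟩
    slack (suc (suc d)) + 2 * b              ∎)
    where
    open ≤-Reasoning
    g₂ = length (forced (suc (suc d)))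
    g₁ = length (forced (suc d))

  slack-≥ : ∀ d → d < m → ⌈ d /2⌉ * e ≤ slack d
  slack-≥ zero          _ = z≤n
  slack-≥ (suc zero)    h = ≤-trans (≤-reflexive (+-identityʳ e)) (slack-one h)
  slack-≥ (suc (suc d)) h = begin
    e + ⌈ d /2⌉ * e      ≡⟨ +-comm e _ ⟩
    ⌈ d /2⌉ * e + e      ≤⟨ +-monoˡ-≤ e (slack-≥ d (<-trans (≤-trans (n<1+n d) (n≤1+n _)) h)) ⟩
    slack d + e          ≤⟨ slack-step d h ⟩
    slack (suc (suc d))  ∎
    where open ≤-Reasoning

module GreedyColouring (b e n : ℕ) (L : ℕ → List ℕ) (uL : ∀ i → Unique (L i))
  (L₀ : length (L 0) ≡ b) (Lₙ : length (L n) ≡ b)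
  (L-inner : ∀ i → 1 ≤ i → i < n → 2 * b + e ≤ length (L i)) where

  open ForcedSets b e n (λ d → L (n ∸ d)) (λ d → uL (n ∸ d)) (≤-reflexive Lₙ)
    (λ d 1≤d d<n → L-inner (n ∸ d) (m<n⇒0<n∸m d<n) (∸-monoʳ-< 1≤d (<⇒≤ d<n))) public

  -- For suc j = n the index n ∸ suc n truncates to 0; the avoided set is then irrelevant.
  colour : ℕ → List ℕ
  colour zero    = L 0
  colour (suc j) = takeAvoiding b (forced (n ∸ suc (suc j))) (L (suc j) ∖ colour j)

  colour⁺ : ∀ j → Unique (colour j)
  colour⁺ zero    = uL 0
  colour⁺ (suc j) = takeAvoiding⁺ b _ (∖⁺ (colour j) (uL (suc j)))

  colour-⊆ : ∀ j → colour j ⊆ L j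
  colour-⊆ zero    x∈ = x∈
  colour-⊆ (suc j) x∈ = proj₁ (∈-∖⁻ (L (suc j)) (colour j) (takeAvoiding-⊆ b _ _ x∈))

  colour-disjoint : ∀ j → Disjoint (colour j) (colour (suc j))
  colour-disjoint j x∈ x∈′ = proj₂ (∈-∖⁻ (L (suc j)) (colour j) (takeAvoiding-⊆ b _ _ x∈′)) x∈

  colour-length≤ : ∀ j → length (colour j) ≤ b
  colour-length≤ zero    = ≤-reflexive L₀
  colour-length≤ (suc j) = length-take≤ b _

  distance-suc : ∀ {j} → suc j < n → n ∸ suc j ≡ suc (n ∸ suc (suc j))
  distance-suc h = +-∸-assoc 1 h

  forced-at : ∀ {j} → suc j < n → forced (n ∸ suc j) ≡ L (suc j) ∖ forced (n ∸ suc (suc j))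
  forced-at {j} h = trans (cong forced (distance-suc h))
    (cong (λ i → L i ∖ forced (n ∸ suc (suc j)))
          (trans (sym (cong (n ∸_) (distance-suc h))) (m∸[m∸n]≡n (<⇒≤ h))))

  slack-at : ∀ {j} → suc j < n →
    slack (n ∸ suc j) + b ≡ length (forced (n ∸ suc j)) + slack (n ∸ suc (suc j))
  slack-at {j} h = subst (λ d → slack d + b ≡ length (forced d) + slack (n ∸ suc (suc j)))
    (sym (distance-suc h)) (slack-suc _ (subst (_< n) (distance-suc h) (∸-monoʳ-< (s≤s z≤n) (<⇒≤ h))))

  module _ (b≤slack : b ≤ slack (n ∸ 1)) where

    colour-avoids : ∀ j → j < n → length (colour j ∩ forced (n ∸ suc j)) ≤ slack (n ∸ suc j)
    colour-avoids zero    _ = ≤-trans (length-∩≤ (L 0) _) (≤-trans (≤-reflexive L₀) b≤slack)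
    colour-avoids (suc j) h = takeAvoiding-∖-∩≤ (L (suc j)) (colour j) F (uL (suc j)) (begin
      length (colour j ∩ (L (suc j) ∖ F)) + b                ≡⟨ cong (λ H → length (colour j ∩ H) + b) (forced-at h) ⟨
      length (colour j ∩ forced (n ∸ suc j)) + b             ≤⟨ +-monoˡ-≤ b (colour-avoids j (<-trans (n<1+n j) h)) ⟩
      slack (n ∸ suc j) + b                                  ≡⟨ slack-at h ⟩
      length (forced (n ∸ suc j)) + slack (n ∸ suc (suc j))  ≡⟨ cong (λ H → length H + slack (n ∸ suc (suc j))) (forced-at h) ⟩
      length (L (suc j) ∖ F) + slack (n ∸ suc (suc j))       ∎)
      where
      open ≤-Reasoning
      F = forced (n ∸ suc (suc j))

    free-colours : ∀ j → suc j ≤ n → b ≤ length (L (suc j) ∖ colour j)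
    free-colours j h with m≤n⇒m<n∨m≡n h
    ... | inj₁ 1+j<n = +-cancelʳ-≤ b b _ (begin
      b + b                                                   ≤⟨ +-monoʳ-≤ b (m≤m+n b 0) ⟩
      2 * b                                                   ≤⟨ m≤m+n (2 * b) e ⟩
      2 * b + e                                               ≤⟨ L-inner (suc j) (s≤s z≤n) 1+j<n ⟩
      length (L (suc j))                                      ≤⟨ length≤∖+∩ (colour j) (uL (suc j)) ⟩
      length (L (suc j) ∖ colour j) + length (colour j ∩ _)   ≤⟨ +-monoʳ-≤ _ (≤-trans (length-∩≤ (colour j) _) (colour-length≤ j)) ⟩
      length (L (suc j) ∖ colour j) + b                       ∎)
      where open ≤-Reasoning
    ... | inj₂ 1+j≡n = begin
      b                                                       ≡⟨ trans (cong (length ∘ L) 1+j≡n) Lₙ ⟨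
      length (L (suc j))                                      ≤⟨ length≤∖+∩ (colour j) (uL (suc j)) ⟩
      length (L (suc j) ∖ colour j) + length (colour j ∩ _)   ≤⟨ +-monoʳ-≤ _ meets-last ⟩
      length (L (suc j) ∖ colour j) + 0                       ≡⟨ +-identityʳ _ ⟩
      length (L (suc j) ∖ colour j)                           ∎
      where
      open ≤-Reasoning
      meets-last : length (colour j ∩ L (suc j)) ≤ 0
      meets-last = subst (λ i → length (colour j ∩ L i) ≤ 0) (sym 1+j≡n)
        (subst (λ d → length (colour j ∩ forced d) ≤ slack d)
          (trans (cong (_∸ suc j) (sym 1+j≡n)) (n∸n≡0 (suc j))) (colour-avoids j h))

    colour-length : ∀ j → j ≤ n → length (colour j) ≡ b
    colour-length zero    _ = L₀
    colour-length (suc j) h =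
      length-takeAvoiding (forced (n ∸ suc (suc j))) (L (suc j) ∖ colour j) (free-colours j h)

    colourable : LbColorablePath n L b
    colourable = colour
      , (λ i i≤n → colour⁺ i , colour-⊆ i , colour-length i i≤n)
      , (λ i _ → colour-disjoint i)

corollary2 : (b e n : ℕ) → 0 < e → 1 ≤ n →
    (L : ℕ → List ℕ) → (∀ i → Unique (L i)) →
    length (L 0) ≡ b → length (L n) ≡ b →
    (∀ i → 1 ≤ i → i < n → length (L i) ≡ 2 * b + e) →
    (p : ℕ) → IsEvenCeil2bOverE b e p → p ≤ n →
    LbColorablePath n L b
corollary2 b e n _ 1≤n L uL L₀ Lₙ L-inner p ((q , p≡2q) , 2b≤pe , _) p≤n = colourable (begin
  b                ≤⟨ b≤qe ⟩
  q * e            ≤⟨ *-monoˡ-≤ e (2*q≤1+n⇒q≤⌈n/2⌉ q (n ∸ 1) 2q≤1+[n∸1]) ⟩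
  ⌈ n ∸ 1 /2⌉ * e  ≤⟨ slack-≥ (n ∸ 1) (∸-monoʳ-< (s≤s z≤n) 1≤n) ⟩
  slack (n ∸ 1)    ∎)
  where
  open GreedyColouring b e n L uL L₀ Lₙ (λ i 1≤i i<n → ≤-reflexive (sym (L-inner i 1≤i i<n)))
  open ≤-Reasoning
  b≤qe : b ≤ q * e
  b≤qe = *-cancelˡ-≤ 2 (≤-trans 2b≤pe (≤-reflexive (trans (cong (_* e) p≡2q) (*-assoc 2 q e))))
  2q≤1+[n∸1] : 2 * q ≤ suc (n ∸ 1)
  2q≤1+[n∸1] = ≤-trans (≤-reflexive (sym p≡2q)) (≤-trans p≤n (≤-reflexive (+-∸-assoc 1 1≤n)))
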